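{- Let $G$ be an $n$-vertex graph and $b\ge2$ an integer with $n\ge4b$. Then there exists an $n$-vertex subgraph $G'$ of $G$ such that $\omega(G')\le b$ and $|E(G)\setminus E(G')|\le n^2/b$.
   Context: $\omega(G')$ denotes the clique number of $G'$ (the maximum number of pairwise adjacent vertices). -}

module Defs where

open import Data.Nat using (ℕ; _≤_; _*_)
open import Data.Bool using (Bool; true; false; T; _∧_; not)
open import Data.Fin using (Fin; _<_)
open import Data.Fin.Properties using (_<?_)
open import Data.List using (List; length; filterᵇ; allFin; cartesianProduct)
open import Data.List.Relation.Unary.Unique.Propositional using (Unique)
open import Data.List.Relation.Unary.AllPairs using (AllPairs)
open import Data.Product using (_×_; _,_)
open import Relation.Binary.PropositionalEquality using (_≡_)
open import Relation.Nullary using (¬_)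
open import Relation.Nullary.Decidable using (⌊_⌋)

record Graph (n : ℕ) : Set where
  field
    adj   : Fin n → Fin n → Bool
    sym   : ∀ i j → adj i j ≡ adj j i
    irrefl : ∀ i → adj i i ≡ false
open Graph public

_⊑_ : ∀ {n} → Graph n → Graph n → Set
G' ⊑ G = ∀ i j → T (adj G' i j) → T (adj G i j)

IsClique : ∀ {n} → Graph n → List (Fin n) → Set
IsClique G vs = Unique vs × AllPairs (λ i j → T (adj G i j)) vs

CliqueNumber≤ : ∀ {n} → Graph n → ℕ → Set
CliqueNumber≤ G b = ∀ vs → IsClique G vs → length vs ≤ b

removedEdges : ∀ {n} → Graph n → Graph n → ℕ
removedEdges {n} G G' =
  length (filterᵇ (λ { (i , j) → ⌊ i <? j ⌋ ∧ adj G i j ∧ not (adj G' i j) })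
                 (cartesianProduct (allFin n) (allFin n)))

-- Colour vertex i by the residue of i modulo b and delete every edge whose
-- endpoints have the same colour. What remains is properly b-coloured, so by
-- pigeonhole it has no clique on more than b vertices. For a fixed i, the
-- vertices j > i with j ≡ i (mod b) are spaced at least b apart inside
-- [i + b, n), so there are at most n / b of them; summing over i, at most
-- n² / b edges are deleted.
module Submission where

open import Defs hiding (sym)
open import Data.Nat using (ℕ; _≤_; _*_)
open import Data.Product using (Σ-syntax; _×_)

open import Data.Nat using (zero; suc; _+_; z≤n; s≤s; NonZero)
  renaming (_<_ to _<ℕ_; _<?_ to _<ℕ?_)
open import Data.Nat.Properties
  using (≤-trans; ≤-reflexive; <⇒≤; <⇒≱; ≮⇒≥; ≰⇒>; _≤?_; m≤n⇒m≤1+n; m≤n+m;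
         +-assoc; +-mono-≤; +-monoˡ-≤; *-monoʳ-≤; *-monoˡ-≤; *-zeroʳ; *-suc; +-comm; +-identityʳ;
         *-distribʳ-+; *-distribˡ-+; module ≤-Reasoning)
open import Data.Nat.DivMod using (_%_; _/_; _mod_; m≡m%n+[m/n]*n; m%n<n)
open import Data.Bool using (Bool; true; false; T; _∧_; not)
open import Data.Bool.Properties using (T-∧)
open import Data.Fin using (Fin; toℕ; _≟_) renaming (_<_ to _<ᶠ_)
open import Data.Fin.Properties using (_<?_; toℕ<n; toℕ-fromℕ<; pigeonhole)
open import Data.List using (List; []; _∷_; length; filterᵇ; allFin; cartesianProduct; map; _++_; lookup)
open import Data.List.Properties using (length-tabulate)
open import Data.List.Membership.Propositional.Properties using (∈-lookup)
open import Data.List.Relation.Unary.All as All using (All; []; _∷_)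
open import Data.List.Relation.Unary.All.Properties using (all-filter)
open import Data.List.Relation.Unary.AllPairs using (AllPairs; []; _∷_)
import Data.List.Relation.Unary.AllPairs.Properties as AllPairs
open import Data.Product using (_,_; proj₁; proj₂)
open import Data.Empty using (⊥-elim)
open import Function using (_∘_; id)
open import Function.Bundles using (Equivalence)
open import Relation.Binary.PropositionalEquality using (module ≡-Reasoning; _≡_; _≢_; refl; sym; trans; subst; cong; cong₂)
open import Relation.Nullary using (yes; no; contradiction)
open import Relation.Nullary.Decidable using (⌊_⌋; T?; toWitness; toWitnessFalse)

T-∧⁻ : ∀ {x y} → T (x ∧ y) → T x × T y
T-∧⁻ = Equivalence.to T-∧

length-filterᵇ-mono : ∀ {A : Set} (p q : A → Bool) → (∀ x → T (p x) → T (q x)) →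
  ∀ xs → length (filterᵇ p xs) ≤ length (filterᵇ q xs)
length-filterᵇ-mono p q p⇒q [] = z≤n
length-filterᵇ-mono p q p⇒q (x ∷ xs) with p x | q x | p⇒q x
... | true  | true  | _   = s≤s (length-filterᵇ-mono p q p⇒q xs)
... | false | true  | _   = m≤n⇒m≤1+n (length-filterᵇ-mono p q p⇒q xs)
... | false | false | _   = length-filterᵇ-mono p q p⇒q xs
... | true  | false | p⇒q = ⊥-elim (p⇒q _)

length-filterᵇ-map-++ : ∀ {A B : Set} (p : A × B → Bool) x ys zs →
  length (filterᵇ p (map (x ,_) ys ++ zs)) ≡
  length (filterᵇ (λ y → p (x , y)) ys) + length (filterᵇ p zs)
length-filterᵇ-map-++ p x []       zs = refl
length-filterᵇ-map-++ p x (y ∷ ys) zs with p (x , y)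
... | true  = cong suc (length-filterᵇ-map-++ p x ys zs)
... | false = length-filterᵇ-map-++ p x ys zs

*-length-filterᵇ-cartesianProduct-≤ : ∀ {A B : Set} (b K : ℕ) (p : A × B → Bool) xs ys →
  (∀ x → b * length (filterᵇ (λ y → p (x , y)) ys) ≤ K) →
  b * length (filterᵇ p (cartesianProduct xs ys)) ≤ length xs * K
*-length-filterᵇ-cartesianProduct-≤ b K p [] ys row≤ = ≤-reflexive (*-zeroʳ b)
*-length-filterᵇ-cartesianProduct-≤ b K p (x ∷ xs) ys row≤ = begin
  b * length (filterᵇ p (map (x ,_) ys ++ cartesianProduct xs ys))
    ≡⟨ cong (b *_) (length-filterᵇ-map-++ p x ys (cartesianProduct xs ys)) ⟩
  b * (length (filterᵇ (λ y → p (x , y)) ys) + length (filterᵇ p (cartesianProduct xs ys)))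
    ≡⟨ *-distribˡ-+ b _ _ ⟩
  b * length (filterᵇ (λ y → p (x , y)) ys) + b * length (filterᵇ p (cartesianProduct xs ys))
    ≤⟨ +-mono-≤ (row≤ x) (*-length-filterᵇ-cartesianProduct-≤ b K p xs ys row≤) ⟩
  K + length xs * K ∎
  where open ≤-Reasoning

All-lookup : ∀ {A : Set} {P : A → Set} {xs : List A} → All P xs → ∀ i → P (lookup xs i)
All-lookup pxs i = All.lookup pxs (∈-lookup i)

AllPairs-lookup : ∀ {A : Set} {R : A → A → Set} {xs : List A} → AllPairs R xs →
  ∀ {i j} → i <ᶠ j → R (lookup xs i) (lookup xs j)
AllPairs-lookup (Rx ∷ _)   {Fin.zero}  {Fin.suc j} _       = All-lookup Rx j
AllPairs-lookup (_  ∷ Rxs) {Fin.suc i} {Fin.suc j} (s≤s i<j) = AllPairs-lookup Rxs i<j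

AllPairs-strengthen : ∀ {A : Set} {P : A → Set} {R S : A → A → Set} →
  (∀ {x y} → P x → P y → R x y → S x y) →
  ∀ {xs} → All P xs → AllPairs R xs → AllPairs S xs
AllPairs-strengthen PPR⇒S []         []         = []
AllPairs-strengthen PPR⇒S (px ∷ pxs) (Rx ∷ Rxs) =
  All.zipWith (λ { (py , Rxy) → PPR⇒S px py Rxy }) (pxs , Rx) ∷ AllPairs-strengthen PPR⇒S pxs Rxs

spaced-+-*-length-≤ : ∀ {n} b lo (xs : List (Fin n)) → lo ≤ n →
  All (λ x → lo + b ≤ toℕ x) xs → AllPairs (λ x y → toℕ x + b ≤ toℕ y) xs →
  lo + b * length xs ≤ n
spaced-+-*-length-≤ b lo [] lo≤n _ _ = begin
  lo + b * 0  ≡⟨ cong (lo +_) (*-zeroʳ b) ⟩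
  lo + 0      ≡⟨ +-identityʳ lo ⟩
  lo          ≤⟨ lo≤n ⟩
  _           ∎
  where open ≤-Reasoning
spaced-+-*-length-≤ {n} b lo (x ∷ xs) _ (lo+b≤x ∷ _) (x+b≤xs ∷ spaced) = begin
  lo + b * suc (length xs)    ≡⟨ cong (lo +_) (*-suc b (length xs)) ⟩
  lo + (b + b * length xs)    ≡⟨ +-assoc lo b _ ⟨
  lo + b + b * length xs      ≤⟨ +-monoˡ-≤ _ lo+b≤x ⟩
  toℕ x + b * length xs       ≤⟨ spaced-+-*-length-≤ b (toℕ x) xs (<⇒≤ (toℕ<n x)) x+b≤xs spaced ⟩
  n                           ∎
  where open ≤-Reasoning

⌊≟⌋-comm : ∀ {b} (x y : Fin b) → ⌊ x ≟ y ⌋ ≡ ⌊ y ≟ x ⌋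
⌊≟⌋-comm x y with x ≟ y | y ≟ x
... | yes _   | yes _   = refl
... | no  _   | no  _   = refl
... | yes x≡y | no  y≢x = contradiction (sym x≡y) y≢x
... | no  x≢y | yes y≡x = contradiction (sym y≡x) x≢y

ProperColouring : ∀ {n b} → Graph n → (Fin n → Fin b) → Set
ProperColouring G c = ∀ i j → T (adj G i j) → c i ≢ c j

properColouring⇒CliqueNumber≤ : ∀ {n b} (G : Graph n) (c : Fin n → Fin b) →
  ProperColouring G c → CliqueNumber≤ G b
properColouring⇒CliqueNumber≤ {b = b} G c proper vs (_ , adjacent) with length vs ≤? b
... | yes |vs|≤b = |vs|≤b
... | no  |vs|≰b =
  let (i , j , i<j , ci≡cj) = pigeonhole (≰⇒> |vs|≰b) (c ∘ lookup vs)
  in  contradiction ci≡cj (proper _ _ (AllPairs-lookup adjacent i<j))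

module _ {n b : ℕ} (G : Graph n) (c : Fin n → Fin b) where

  removeMonochromatic : Graph n
  removeMonochromatic = record
    { adj    = λ i j → adj G i j ∧ not ⌊ c i ≟ c j ⌋
    ; sym    = λ i j → cong₂ (λ e m → e ∧ not m) (Graph.sym G i j)
                         (⌊≟⌋-comm (c i) (c j))
    ; irrefl = λ i → cong (_∧ not ⌊ c i ≟ c i ⌋) (irrefl G i)
    }

  removeMonochromatic-⊑ : removeMonochromatic ⊑ G
  removeMonochromatic-⊑ i j = proj₁ ∘ T-∧⁻ {adj G i j}

  removeMonochromatic-proper : ProperColouring removeMonochromatic c
  removeMonochromatic-proper i j = toWitnessFalse {a? = c i ≟ c j} ∘ proj₂ ∘ T-∧⁻ {adj G i j}

monochromaticPair : ∀ {n b} → (Fin n → Fin b) → Fin n × Fin n → Bool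
monochromaticPair c (i , j) = ⌊ i <? j ⌋ ∧ ⌊ c i ≟ c j ⌋

monochromaticPairs : ∀ {n b} → (Fin n → Fin b) → ℕ
monochromaticPairs {n} c = length (filterᵇ (monochromaticPair c) (cartesianProduct (allFin n) (allFin n)))

removedEdges-removeMonochromatic-≤ : ∀ {n b} (G : Graph n) (c : Fin n → Fin b) →
  removedEdges G (removeMonochromatic G c) ≤ monochromaticPairs c
removedEdges-removeMonochromatic-≤ {n} G c =
  length-filterᵇ-mono _ (monochromaticPair c)
    (λ { (i , j) → removed⇒monochromatic ⌊ i <? j ⌋ (adj G i j) ⌊ c i ≟ c j ⌋ })
    (cartesianProduct (allFin n) (allFin n))
  where
  removed⇒monochromatic : ∀ lt e m → T (lt ∧ e ∧ not (e ∧ not m)) → T (lt ∧ m)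
  removed⇒monochromatic true true true _ = _

module _ (b : ℕ) .{{_ : NonZero b}} where

  %-≡⇒+*-≤ : ∀ k {x y} → x % b ≡ y % b → k + x / b ≤ y / b → x + k * b ≤ y
  %-≡⇒+*-≤ k {x} {y} x%≡y% k+x/≤y/ = begin
    x + k * b                    ≡⟨ cong (_+ k * b) (m≡m%n+[m/n]*n x b) ⟩
    x % b + x / b * b + k * b    ≡⟨ +-assoc (x % b) _ _ ⟩
    x % b + (x / b * b + k * b)  ≡⟨ cong (x % b +_) (sym (*-distribʳ-+ b (x / b) k)) ⟩
    x % b + (x / b + k) * b      ≡⟨ cong (λ m → x % b + m * b) (+-comm (x / b) k) ⟩
    x % b + (k + x / b) * b      ≤⟨ +-mono-≤ (≤-reflexive x%≡y%) (*-monoˡ-≤ b k+x/≤y/) ⟩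
    y % b + y / b * b            ≡⟨ m≡m%n+[m/n]*n y b ⟨
    y                            ∎
    where open ≤-Reasoning

  %-≡∧<⇒+-≤ : ∀ {x y} → x % b ≡ y % b → x <ℕ y → x + b ≤ y
  %-≡∧<⇒+-≤ {x} {y} x%≡y% x<y = begin
    x + b      ≡⟨ cong (x +_) (+-identityʳ b) ⟨
    x + 1 * b  ≤⟨ %-≡⇒+*-≤ 1 x%≡y% x/<y/ ⟩
    y          ∎
    where
    open ≤-Reasoning
    x/<y/ : x / b <ℕ y / b
    x/<y/ with x / b <ℕ? y / b
    ... | yes x/<y/ = x/<y/
    ... | no  x/≮y/ = contradiction (subst (_≤ x) (+-identityʳ y) (%-≡⇒+*-≤ 0 (sym x%≡y%) (≮⇒≥ x/≮y/)))
                        (<⇒≱ x<y)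

  residue : ∀ {n} → Fin n → Fin b
  residue i = toℕ i mod b

  residue-≡⇒%-≡ : ∀ {n} {i j : Fin n} → residue i ≡ residue j → toℕ i % b ≡ toℕ j % b
  residue-≡⇒%-≡ {i = i} {j} eq = begin
    toℕ i % b        ≡⟨ toℕ-fromℕ< (m%n<n (toℕ i) b) ⟨
    toℕ (residue i)  ≡⟨ cong toℕ eq ⟩
    toℕ (residue j)  ≡⟨ toℕ-fromℕ< (m%n<n (toℕ j) b) ⟩
    toℕ j % b        ∎
    where open ≡-Reasoning

  *-length-monochromaticRow-≤ : ∀ {n} (i : Fin n) →
    b * length (filterᵇ (λ j → monochromaticPair residue (i , j)) (allFin n)) ≤ n
  *-length-monochromaticRow-≤ {n} i =
    ≤-trans (m≤n+m _ (toℕ i))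
      (spaced-+-*-length-≤ b (toℕ i) row (<⇒≤ (toℕ<n i))
        (All.map (λ (i<j , i%≡j%) → %-≡∧<⇒+-≤ i%≡j% i<j) later)
        (AllPairs-strengthen (λ (_ , i%≡x%) (_ , i%≡y%) → %-≡∧<⇒+-≤ (trans (sym i%≡x%) i%≡y%))
          later sorted))
    where
    row : List (Fin n)
    row = filterᵇ (λ j → monochromaticPair residue (i , j)) (allFin n)
    SameResidueAfter : Fin n → Set
    SameResidueAfter j = i <ᶠ j × toℕ i % b ≡ toℕ j % b
    decode : ∀ {j} → T (monochromaticPair residue (i , j)) → SameResidueAfter j
    decode {j} t =
      let (i<j , i≡j) = T-∧⁻ {⌊ i <? j ⌋} t
      in  toWitness {a? = i <? j} i<j , residue-≡⇒%-≡ (toWitness {a? = residue i ≟ residue j} i≡j)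
    later : All SameResidueAfter row
    later = All.map decode (all-filter (T? ∘ λ j → monochromaticPair residue (i , j)) (allFin n))
    sorted : AllPairs _<ᶠ_ row
    sorted = AllPairs.filter⁺ _ (AllPairs.tabulate⁺-< id)

  *-monochromaticPairs-residue-≤ : ∀ {n} → b * monochromaticPairs (residue {n}) ≤ n * n
  *-monochromaticPairs-residue-≤ {n} = begin
    b * monochromaticPairs (residue {n})
      ≤⟨ *-length-filterᵇ-cartesianProduct-≤ b n _ (allFin n) (allFin n) *-length-monochromaticRow-≤ ⟩
    length (allFin n) * n
      ≡⟨ cong (_* n) (length-tabulate {n = n} id) ⟩
    n * n ∎
    where open ≤-Reasoning

lemma4p11 : (n b : ℕ) → (G : Graph n) → 2 ≤ b → 4 * b ≤ n →
    Σ[ G' ∈ Graph n ] (G' ⊑ G × CliqueNumber≤ G' b × b * removedEdges G G' ≤ n * n)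
lemma4p11 n zero G () _
lemma4p11 n b@(suc _) G _ _ =
  G' ,
  removeMonochromatic-⊑ G c ,
  properColouring⇒CliqueNumber≤ G' c (removeMonochromatic-proper G c) ,
  ≤-trans (*-monoʳ-≤ b (removedEdges-removeMonochromatic-≤ G c)) (*-monochromaticPairs-residue-≤ b {n})
  where
  c : Fin n → Fin b
  c = residue b
  G' : Graph n
  G' = removeMonochromatic G c
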